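{- Let $N$ be a sequential circuit with set of state variables $S$, transition relation $T(S',S'')$ (where $S'$, $S''$ are present- and next-state copies of $S$) and initial states given by $I(S)$, and assume $N$ can stutter, i.e. $T(s,s)=1$ for every state $s$. Let $k \ge 1$. For $i = 1,\dots,k+1$ let $S_i$ be a copy of $S$ (the state variables of the $i$-th time frame), let $I_1 = I(S_1)$, $I_2 = I(S_2)$, let $T_{1,k} = T(S_1,S_2) \wedge \dots \wedge T(S_k,S_{k+1})$, and let $A_k = S_1 \cup \dots \cup S_k$. Then $d(N,I) < k$ if and only if $I_2$ is redundant in $\exists A_k\,[I_1 \wedge I_2 \wedge T_{1,k}]$, i.e. $\exists A_k\,[I_1 \wedge I_2 \wedge T_{1,k}] \equiv \exists A_k\,[I_1 \wedge T_{1,k}]$.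
   Context: A state is a full assignment to $S$. A state $s_{k+1}$ is reachable in $k$ transitions if there are states $s_1,\dots,s_{k+1}$ with $I(s_1)=1$ and $T(s_i,s_{i+1})=1$ for $i=1,\dots,k$; because $N$ stutters, a state reachable in $p$ transitions is reachable in every $q>p$ transitions. A state is reachable if it is reachable in some number of transitions. The reachability diameter $d(N,I)$ is the least number $d$ such that every reachable state of $N$ is reachable in at most $d$ transitions. Formulas $I$ and $T$ are CNF formulas, viewed as sets of clauses. Two formulas (possibly with existential quantifiers) are equivalent ($\equiv$) if they take the same value under every full assignment to their free variables; here the free variables are $S_{k+1}$. -}

module Defs where

open import Data.Nat using (ℕ; zero; suc; _<_; _≤_; _≡ᵇ_)
open import Data.Fin using (Fin)
open import Data.Bool using (Bool; true; false; not; _∧_; _∨_; if_then_else_)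
open import Data.List using (List; []; _∷_)
open import Data.Sum using (_⊎_; inj₁; inj₂)
open import Data.Product using (Σ; ∃; _×_)
open import Relation.Binary.PropositionalEquality using (_≡_)

data Lit (V : Set) : Set where
  pos : V → Lit V
  neg : V → Lit V

Clause : Set → Set
Clause V = List (Lit V)

CNF : Set → Set
CNF V = List (Clause V)

evalLit : {V : Set} → (V → Bool) → Lit V → Bool
evalLit a (pos v) = a v
evalLit a (neg v) = not (a v)

evalClause : {V : Set} → (V → Bool) → Clause V → Bool
evalClause a []       = false
evalClause a (l ∷ c)  = evalLit a l ∨ evalClause a c

evalCNF : {V : Set} → (V → Bool) → CNF V → Bool
evalCNF a []       = true
evalCNF a (c ∷ f)  = evalClause a c ∧ evalCNF a f

State : ℕ → Set
State n = Fin n → Bool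

-- I(S) is a CNF over S; T(S',S'') is a CNF over S' ⊎ S''
-- (inj₁ = present-state copy S', inj₂ = next-state copy S'')
pair : {n : ℕ} → State n → State n → (Fin n ⊎ Fin n → Bool)
pair s t (inj₁ v) = s v
pair s t (inj₂ v) = t v

Init : {n : ℕ} → CNF (Fin n) → State n → Set
Init I s = evalCNF s I ≡ true

Trans : {n : ℕ} → CNF (Fin n ⊎ Fin n) → State n → State n → Set
Trans T s t = evalCNF (pair s t) T ≡ true

Stutters : {n : ℕ} → CNF (Fin n ⊎ Fin n) → Set
Stutters {n} T = (s : State n) → Trans T s s

-- s is reachable in k transitions: there are states s_1..s_{k+1}
-- (here p 0 .. p k) with I(s_1)=1, T(s_i,s_{i+1})=1, and s_{k+1} = s
ReachableIn : {n : ℕ} → CNF (Fin n) → CNF (Fin n ⊎ Fin n) → ℕ → State n → Set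
ReachableIn {n} I T k s =
  Σ (ℕ → State n) λ p →
    Init I (p 0) × ((i : ℕ) → i < k → Trans T (p i) (p (suc i)))
      × ((v : Fin n) → p k v ≡ s v)

Reachable : {n : ℕ} → CNF (Fin n) → CNF (Fin n ⊎ Fin n) → State n → Set
Reachable I T s = ∃ λ k → ReachableIn I T k s

Bounds : {n : ℕ} → CNF (Fin n) → CNF (Fin n ⊎ Fin n) → ℕ → Set
Bounds {n} I T d =
  (s : State n) → Reachable I T s → ∃ λ j → j ≤ d × ReachableIn I T j s

IsDiameter : {n : ℕ} → CNF (Fin n) → CNF (Fin n ⊎ Fin n) → ℕ → Set
IsDiameter I T d = Bounds I T d × ((d' : ℕ) → Bounds I T d' → d ≤ d')

-- Full assignment to the frames S_1..S_{k+1} (indices 0..k): the free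
-- variables S_{k+1} (index k) get the state s, the quantified variables
-- A_k = S_1 ∪ ... ∪ S_k get their values from p.
frames : {n : ℕ} → ℕ → (ℕ → State n) → State n → ℕ → State n
frames k p s i = if i ≡ᵇ k then s else p i

Chain : {n : ℕ} → CNF (Fin n ⊎ Fin n) → ℕ → (ℕ → State n) → Set
Chain T k f = (i : ℕ) → i < k → Trans T (f i) (f (suc i))

ExI1I2T : {n : ℕ} → CNF (Fin n) → CNF (Fin n ⊎ Fin n) → ℕ → State n → Set
ExI1I2T {n} I T k s = Σ (ℕ → State n) λ p →
  let f = frames k p s in Init I (f 0) × Init I (f 1) × Chain T k f

ExI1T : {n : ℕ} → CNF (Fin n) → CNF (Fin n ⊎ Fin n) → ℕ → State n → Set
ExI1T {n} I T k s = Σ (ℕ → State n) λ p →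
  let f = frames k p s in Init I (f 0) × Chain T k f

-- Unfolding the quantified frames, ∃A_k [I_1 ∧ T_{1,k}] holds at s exactly when s is reachable
-- in k transitions, and ∃A_k [I_1 ∧ I_2 ∧ T_{1,k}] exactly when s is reachable in k − 1
-- transitions (the extra initial frame is absorbed by a stutter step). So the equivalence says
-- that the states reachable in k transitions are already reachable in k − 1, i.e. that k − 1
-- bounds the reachability diameter. A diameter exists because the sets of states reachable in
-- m transitions form an increasing chain of subsets of a finite set, hence stop growing.
module Submission where

open import Defs
open import Data.Bool using (Bool; true; false; not; _∧_; _∨_; T)
open import Data.Bool.Properties using () renaming (_≟_ to _≟ᵇ_)
open import Data.Empty using (⊥-elim)
open import Data.Fin using (Fin; zero; suc)
open import Data.List using (List; []; _∷_; length; filter; cartesianProductWith)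
open import Data.List.Membership.Propositional using (_∈_; lose)
open import Data.List.Membership.Propositional.Properties using (∈-cartesianProductWith⁺)
open import Data.List.Properties using (length-filter)
open import Data.List.Relation.Unary.Any using (Any; here; there; any?; satisfied)
open import Data.Nat using (ℕ; zero; suc; _+_; _<_; _≤_; _≤′_; ≤′-refl; ≤′-step; _≡ᵇ_; z≤n; s≤s)
open import Data.Nat.Properties
  using (≤-refl; ≤-trans; ≤-<-trans; <⇒≢; <⇒≱; ≮⇒≥; m<n⇒m<1+n; m≤n⇒m≤1+n; m<1+n⇒m<n∨m≡n;
         +-suc; +-monoʳ-≤; m≤m+n; ≤⇒≤′; ≡ᵇ⇒≡; ≡⇒≡ᵇ)
open import Data.Product using (∃; ∃-syntax; _×_; _,_)
open import Data.Sum using (_⊎_; inj₁; inj₂)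
open import Data.Unit using (tt)
import Data.Vec.Functional as Vector
open import Level using (0ℓ)
open import Function.Base using (_∘_)
open import Function.Bundles using (_⇔_; mk⇔; Equivalence)
import Function.Properties.Equivalence as ⇔
open import Relation.Binary.PropositionalEquality
  using (_≡_; _≗_; refl; sym; trans; cong; cong₂; cong-app; subst; subst₂)
open import Relation.Nullary using (¬_; yes; no; contradiction; ¬?; _×-dec_)
import Relation.Nullary.Decidable as Dec
open import Relation.Unary using (Pred; Decidable; _⊆_)

evalLit-cong : {V : Set} {a b : V → Bool} → a ≗ b → ∀ l → evalLit a l ≡ evalLit b l
evalLit-cong a≗b (pos v) = a≗b v
evalLit-cong a≗b (neg v) = cong not (a≗b v)

evalClause-cong : {V : Set} {a b : V → Bool} → a ≗ b → ∀ c → evalClause a c ≡ evalClause b c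
evalClause-cong a≗b []      = refl
evalClause-cong a≗b (l ∷ c) = cong₂ _∨_ (evalLit-cong a≗b l) (evalClause-cong a≗b c)

evalCNF-cong : {V : Set} {a b : V → Bool} → a ≗ b → ∀ F → evalCNF a F ≡ evalCNF b F
evalCNF-cong a≗b []      = refl
evalCNF-cong a≗b (c ∷ F) = cong₂ _∧_ (evalClause-cong a≗b c) (evalCNF-cong a≗b F)

pair-cong : ∀ {n} {s s′ t t′ : State n} → s ≗ s′ → t ≗ t′ → pair s t ≗ pair s′ t′
pair-cong s≗s′ t≗t′ (inj₁ v) = s≗s′ v
pair-cong s≗s′ t≗t′ (inj₂ v) = t≗t′ v

module _ {n : ℕ} (k : ℕ) (p : ℕ → State n) (s : State n) where

  frames-at : frames k p s k ≡ s
  frames-at with k ≡ᵇ k in eq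
  ... | true  = refl
  ... | false = ⊥-elim (subst T eq (≡⇒≡ᵇ k k refl))

  frames-below : ∀ {i} → i < k → frames k p s i ≡ p i
  frames-below {i} i<k with i ≡ᵇ k in eq
  ... | true  = contradiction (≡ᵇ⇒≡ i k (subst T (sym eq) tt)) (<⇒≢ i<k)
  ... | false = refl

  frames-agree : p k ≗ s → ∀ i → p i ≗ frames k p s i
  frames-agree pk≗s i with i ≡ᵇ k in eq
  ... | true with refl ← ≡ᵇ⇒≡ i k (subst T (sym eq) tt) = pk≗s
  ... | false = λ _ → refl

allStates : ∀ n → List (State n)
allStates zero    = (λ ()) ∷ []
allStates (suc n) = cartesianProductWith Vector._∷_ (false ∷ true ∷ []) (allStates n)

allStates-complete : ∀ {n} (s : State n) → ∃[ u ] u ∈ allStates n × u ≗ s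
allStates-complete {zero}  s = (λ ()) , here refl , λ ()
allStates-complete {suc n} s with u , u∈ , u≗ ← allStates-complete (Vector.tail s) =
  Vector.head s Vector.∷ u , ∈-cartesianProductWith⁺ Vector._∷_ (bool∈ (Vector.head s)) u∈ , cons≗
  where
    bool∈ : ∀ b → b ∈ false ∷ true ∷ []
    bool∈ false = here refl
    bool∈ true  = there (here refl)
    cons≗ : Vector.head s Vector.∷ u ≗ s
    cons≗ zero    = refl
    cons≗ (suc i) = u≗ i

any-allStates : ∀ {n} {P : Pred (State n) 0ℓ} → (∀ {s t} → s ≗ t → P s → P t)
  → ∀ {s} → P s → Any P (allStates n)
any-allStates resp {s} ps with u , u∈ , u≗s ← allStates-complete s =
  lose u∈ (resp (sym ∘ u≗s) ps)

module _ {A : Set} {P Q : Pred A 0ℓ} (P? : Decidable P) (Q? : Decidable Q) (P⊆Q : P ⊆ Q) where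

  length-filter-mono : ∀ xs → length (filter P? xs) ≤ length (filter Q? xs)
  length-filter-mono []       = z≤n
  length-filter-mono (x ∷ xs) with P? x | Q? x
  ... | yes _  | yes _  = s≤s (length-filter-mono xs)
  ... | yes px | no ¬qx = contradiction (P⊆Q px) ¬qx
  ... | no _   | yes _  = m≤n⇒m≤1+n (length-filter-mono xs)
  ... | no _   | no _   = length-filter-mono xs

  length-filter-< : ∀ {xs} → Any (λ x → Q x × ¬ P x) xs
    → length (filter P? xs) < length (filter Q? xs)
  length-filter-< {x ∷ xs} (here (qx , ¬px)) with P? x | Q? x
  ... | yes px | _      = contradiction px ¬px
  ... | no _   | yes _  = s≤s (length-filter-mono xs)
  ... | no _   | no ¬qx = contradiction qx ¬qx
  length-filter-< {x ∷ xs} (there any) with P? x | Q? x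
  ... | yes _  | yes _  = s≤s (length-filter-< any)
  ... | yes px | no ¬qx = contradiction (P⊆Q px) ¬qx
  ... | no _   | yes _  = m<n⇒m<1+n (length-filter-< any)
  ... | no _   | no _   = length-filter-< any

module Stabilisation {A : Set} {P : ℕ → Pred A 0ℓ}
  (P? : ∀ m → Decidable (P m)) (P-mono : ∀ m → P m ⊆ P (suc m)) (xs : List A) where

  Grows : ℕ → Set
  Grows m = Any (λ x → P (suc m) x × ¬ P m x) xs

  size : ℕ → ℕ
  size m = length (filter (P? m) xs)

  size-grows : ∀ {m} → Grows m → size m < size (suc m)
  size-grows {m} = length-filter-< (P? m) (P? (suc m)) (P-mono m)

  stabilises : ∃[ D ] ¬ Grows D × (∀ {e} → e < D → Grows e)
  stabilises = search (length xs) 0 (m≤m+n (length xs) _) (λ ())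
    where
      search : ∀ fuel d → length xs ≤ fuel + size d → (∀ {e} → e < d → Grows e)
        → ∃[ D ] ¬ Grows D × (∀ {e} → e < D → Grows e)
      search fuel d bound below with any? (λ x → P? (suc d) x ×-dec ¬? (P? d x)) xs
      ... | no ¬grows = d , ¬grows , below
      search zero d bound below | yes grows =
        contradiction (length-filter (P? (suc d)) xs) (<⇒≱ (≤-<-trans bound (size-grows grows)))
      search (suc fuel) d bound below | yes grows =
        search fuel (suc d) bound′ below′
        where
          bound′ : length xs ≤ fuel + size (suc d)
          bound′ = ≤-trans bound (subst (_≤ fuel + size (suc d)) (+-suc fuel (size d))
                                   (+-monoʳ-≤ fuel (size-grows grows)))
          below′ : ∀ {e} → e < suc d → Grows e
          below′ e<1+d with m<1+n⇒m<n∨m≡n e<1+d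
          ... | inj₁ e<d  = below e<d
          ... | inj₂ refl = grows

module Reachability {n : ℕ} (I : CNF (Fin n)) (T : CNF (Fin n ⊎ Fin n)) (stutters : Stutters T) where

  Init-resp : ∀ {s s′} → s ≗ s′ → Init I s → Init I s′
  Init-resp s≗s′ init = trans (evalCNF-cong (sym ∘ s≗s′) I) init

  Trans-resp : ∀ {s s′ t t′} → s ≗ s′ → t ≗ t′ → Trans T s t → Trans T s′ t′
  Trans-resp s≗s′ t≗t′ tr = trans (evalCNF-cong (pair-cong (sym ∘ s≗s′) (sym ∘ t≗t′)) T) tr

  ReachableIn-resp : ∀ {m s s′} → s ≗ s′ → ReachableIn I T m s → ReachableIn I T m s′
  ReachableIn-resp s≗s′ (p , init , chain , pm≗s) = p , init , chain , λ v → trans (pm≗s v) (s≗s′ v)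

  ReachableIn-zero⇔ : ∀ {s} → ReachableIn I T 0 s ⇔ Init I s
  ReachableIn-zero⇔ {s} = mk⇔ (λ (p , init , _ , p0≗s) → Init-resp p0≗s init)
                              (λ init → (λ _ → s) , init , (λ _ ()) , (λ _ → refl))

  ReachableIn-step : ∀ {m s t} → ReachableIn I T m t → Trans T t s → ReachableIn I T (suc m) s
  ReachableIn-step {m} {s} (p , init , chain , pm≗t) tr =
    frames (suc m) p s , init , chain′ , cong-app (frames-at (suc m) p s)
    where
      below : ∀ {i} → i < suc m → frames (suc m) p s i ≡ p i
      below = frames-below (suc m) p s
      chain′ : ∀ i → i < suc m → Trans T (frames (suc m) p s i) (frames (suc m) p s (suc i))
      chain′ i i<1+m with m<1+n⇒m<n∨m≡n i<1+m
      ... | inj₁ i<m  = subst₂ (Trans T) (sym (below (m<n⇒m<1+n i<m))) (sym (below (s≤s i<m)))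
                          (chain i i<m)
      ... | inj₂ refl = subst₂ (Trans T) (sym (below i<1+m)) (sym (frames-at (suc m) p s))
                          (Trans-resp (sym ∘ pm≗t) (λ _ → refl) tr)

  ReachableIn-unstep : ∀ {m s} → ReachableIn I T (suc m) s
    → ∃[ t ] ReachableIn I T m t × Trans T t s
  ReachableIn-unstep {m} (p , init , chain , p1+m≗s) =
    p m , (p , init , (λ i i<m → chain i (m<n⇒m<1+n i<m)) , (λ _ → refl)) ,
    Trans-resp (λ _ → refl) p1+m≗s (chain m ≤-refl)

  ReachableIn? : ∀ m → Decidable (ReachableIn I T m)
  ReachableIn? zero    s = Dec.map (⇔.sym ReachableIn-zero⇔) (evalCNF s I ≟ᵇ true)
  ReachableIn? (suc m) s =
    Dec.map (mk⇔ from-witness to-witness)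
      (any? (λ t → ReachableIn? m t ×-dec (evalCNF (pair t s) T ≟ᵇ true)) (allStates n))
    where
      Witness : State n → Set
      Witness t = ReachableIn I T m t × Trans T t s
      from-witness : Any Witness (allStates n) → ReachableIn I T (suc m) s
      from-witness any with _ , r , tr ← satisfied any = ReachableIn-step r tr
      to-witness : ReachableIn I T (suc m) s → Any Witness (allStates n)
      to-witness r with _ , r′ , tr ← ReachableIn-unstep r =
        any-allStates (λ t≗t′ (r , tr) → ReachableIn-resp t≗t′ r , Trans-resp t≗t′ (λ _ → refl) tr)
          (r′ , tr)

  ReachableIn-stutter : ∀ {m s} → ReachableIn I T m s → ReachableIn I T (suc m) s
  ReachableIn-stutter {s = s} r = ReachableIn-step r (stutters s)

  ReachableIn-mono : ∀ {j m s} → j ≤ m → ReachableIn I T j s → ReachableIn I T m s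
  ReachableIn-mono j≤m = mono′ (≤⇒≤′ j≤m)
    where
      mono′ : ∀ {j m s} → j ≤′ m → ReachableIn I T j s → ReachableIn I T m s
      mono′ ≤′-refl        r = r
      mono′ (≤′-step j≤′m) r = ReachableIn-stutter (mono′ j≤′m r)

  Closed : ℕ → Set
  Closed d = ∀ s → ReachableIn I T (suc d) s → ReachableIn I T d s

  closed⇒confined : ∀ {d} → Closed d → ∀ m {s} → ReachableIn I T m s → ReachableIn I T d s
  closed⇒confined closed zero    r = ReachableIn-mono z≤n r
  closed⇒confined closed (suc m) r with t , r′ , tr ← ReachableIn-unstep r =
    closed _ (ReachableIn-step (closed⇒confined closed m r′) tr)

  closed⇒bounds : ∀ {d} → Closed d → Bounds I T d
  closed⇒bounds {d} closed s (m , r) = d , ≤-refl , closed⇒confined closed m r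

  bounds⇒closed : ∀ {d} → Bounds I T d → Closed d
  bounds⇒closed {d} bounds s r with j , j≤d , r′ ← bounds s (suc d , r) = ReachableIn-mono j≤d r′

  bounds-mono : ∀ {d d′} → d ≤ d′ → Bounds I T d → Bounds I T d′
  bounds-mono d≤d′ bounds s reach with j , j≤d , r ← bounds s reach = j , ≤-trans j≤d d≤d′ , r

  open Stabilisation ReachableIn? (λ _ → ReachableIn-stutter) (allStates n) using (Grows; stabilises)

  closed⇒¬grows : ∀ {d} → Closed d → ¬ Grows d
  closed⇒¬grows closed grows with u , r , ¬r ← satisfied grows = ¬r (closed u r)

  ¬grows⇒closed : ∀ {d} → ¬ Grows d → Closed d
  ¬grows⇒closed {d} ¬grows s r with ReachableIn? d s
  ... | yes r′ = r′
  ... | no ¬r′ = contradiction (any-allStates resp (r , ¬r′)) ¬grows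
    where
      resp : ∀ {s t} → s ≗ t → ReachableIn I T (suc d) s × ¬ ReachableIn I T d s
                             → ReachableIn I T (suc d) t × ¬ ReachableIn I T d t
      resp s≗t (r , ¬r) = ReachableIn-resp s≗t r , ¬r ∘ ReachableIn-resp (sym ∘ s≗t)

  diameter : ∃ (IsDiameter I T)
  diameter with D , ¬grows , grows-below ← stabilises =
    D , closed⇒bounds (¬grows⇒closed ¬grows) ,
    λ d bounds → ≮⇒≥ λ d<D → closed⇒¬grows (bounds⇒closed bounds) (grows-below d<D)

  diameter<⇔closed : ∀ k → (∀ d → IsDiameter I T d → d < suc k) ⇔ Closed k
  diameter<⇔closed k = mk⇔ to (λ closed d (_ , least) → s≤s (least k (closed⇒bounds closed)))
    where
      to : (∀ d → IsDiameter I T d → d < suc k) → Closed k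
      to below with D , isDiameter@(bounds , _) ← diameter with s≤s D≤k ← below D isDiameter =
        bounds⇒closed (bounds-mono D≤k bounds)

  ExI1T⇔ReachableIn : ∀ k s → ExI1T I T k s ⇔ ReachableIn I T k s
  ExI1T⇔ReachableIn k s =
    mk⇔ (λ (p , init , chain) → frames k p s , init , chain , cong-app (frames-at k p s))
    λ (q , init , chain , qk≗s) →
      let agree = frames-agree k q s qk≗s in
      q , Init-resp (agree 0) init , λ i i<k → Trans-resp (agree i) (agree (suc i)) (chain i i<k)

  -- frames (suc k) p s ∘ suc is definitionally frames k (p ∘ suc) s, and the extra initial
  -- frame is joined to the rest by a stutter step.
  ExI1I2T-suc⇔ExI1T : ∀ k s → ExI1I2T I T (suc k) s ⇔ ExI1T I T k s
  ExI1I2T-suc⇔ExI1T k s =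
    mk⇔ (λ (p , _ , init , chain) → p ∘ suc , init , λ i i<k → chain (suc i) (s≤s i<k))
    λ (p , init , chain) → let first = frames k p s 0 in
      (λ { zero → first ; (suc i) → p i }) , init , init ,
      λ { zero _ → stutters first ; (suc i) (s≤s i<k) → chain i i<k }

  ExI1I2T⇔ReachableIn : ∀ k s → ExI1I2T I T (suc k) s ⇔ ReachableIn I T k s
  ExI1I2T⇔ReachableIn k s = ⇔.trans (ExI1I2T-suc⇔ExI1T k s) (ExI1T⇔ReachableIn k s)

  closed⇔I₂-redundant : ∀ k → Closed k ⇔ (∀ s → ExI1I2T I T (suc k) s ⇔ ExI1T I T (suc k) s)
  closed⇔I₂-redundant k = mk⇔ to from
    where
      to : Closed k → ∀ s → ExI1I2T I T (suc k) s ⇔ ExI1T I T (suc k) s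
      to closed s = ⇔.trans (ExI1I2T⇔ReachableIn k s)
        (⇔.trans (mk⇔ ReachableIn-stutter (closed s)) (⇔.sym (ExI1T⇔ReachableIn (suc k) s)))
      from : (∀ s → ExI1I2T I T (suc k) s ⇔ ExI1T I T (suc k) s) → Closed k
      from redundant s = Equivalence.to (ExI1I2T⇔ReachableIn k s) ∘ Equivalence.from (redundant s)
                         ∘ Equivalence.from (ExI1T⇔ReachableIn (suc k) s)

proposition4 : (n : ℕ) (I : CNF (Fin n)) (T : CNF (Fin n ⊎ Fin n))
    → Stutters T → (k : ℕ) → 1 ≤ k
    → ((d : ℕ) → IsDiameter I T d → d < k)
      ⇔ ((s : State n) → ExI1I2T I T k s ⇔ ExI1T I T k s)
proposition4 n I T stutters zero    ()
proposition4 n I T stutters (suc k) _ = ⇔.trans (diameter<⇔closed k) (closed⇔I₂-redundant k)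
  where open Reachability I T stutters
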